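{- Let $\mathcal M$ be an $EL3^-$-model and $\gamma$ an assignment in $\mathcal M$. For all formulas $\varphi,\psi$: $(\mathcal M,\gamma)\vDash\varphi\equiv\psi$ if and only if $\gamma(\varphi)=\gamma(\psi)$.
   Context: Formulas are built from propositional variables (set $V$) using $\bot,\wedge,\vee,\rightarrow$ and unary $\square,K$; $\varphi\leftrightarrow\psi:=(\varphi\rightarrow\psi)\wedge(\psi\rightarrow\varphi)$ and $\varphi\equiv\psi:=\square(\varphi\leftrightarrow\psi)$. An $EL3^-$-model is a Heyting algebra $(M,f_\bot,f_\top,f_\vee,f_\wedge,f_\rightarrow)$ with order $\le$, together with a designated ultrafilter $\mathit{TRUE}\subseteq M$, a set $\mathit{BEL}\subseteq M$ and unary operations $f_\square,f_K$ such that for all $m,m'\in M$: (i) $f_\square(f_\vee(m,m'))\le f_\vee(f_\square(m),f_\square(m'))$; (ii) $f_\square(m)\le m$; (iii) $f_\square(f_\rightarrow(m,m'))\le f_\square(f_\rightarrow(f_\square(m),f_\square(m')))$; (iv) $f_\square(m)\in\mathit{TRUE}\iff m=f_\top$; (v) $f_K(m)\in\mathit{TRUE}\iff m\in\mathit{BEL}$; (vi) $f_K(f_\rightarrow(m,m'))\le f_\rightarrow(f_K(m),f_K(m'))$; (vii) $f_\square(m)\le f_\square(f_K(m))$. An assignment is a map $\gamma:V\to M$, extended to all formulas by $\gamma(\bot)=f_\bot$, $\gamma(\square\varphi)=f_\square(\gamma(\varphi))$, $\gamma(K\varphi)=f_K(\gamma(\varphi))$, $\gamma(\varphi*\psi)=f_*(\gamma(\varphi),\gamma(\psi))$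 for $*\in\{\vee,\wedge,\rightarrow\}$. $(\mathcal M,\gamma)\vDash\varphi$ iff $\gamma(\varphi)\in\mathit{TRUE}$. -}

module Defs where

open import Level using (Level; _⊔_; suc)
open import Data.Product using (_×_)
open import Relation.Nullary using (¬_)
open import Relation.Unary using (Pred; _∈_; _∉_; _⊆_)
open import Relation.Binary.Lattice.Bundles using (HeytingAlgebra)

data Formula {v : Level} (V : Set v) : Set v where
  var  : V → Formula V
  ⊥'   : Formula V
  _∧'_ : Formula V → Formula V → Formula V
  _∨'_ : Formula V → Formula V → Formula V
  _→'_ : Formula V → Formula V → Formula V
  □    : Formula V → Formula V
  K    : Formula V → Formula V

infixr 6 _∨'_
infixr 7 _∧'_
infixr 5 _→'_

_↔'_ : ∀ {v} {V : Set v} → Formula V → Formula V → Formula V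
φ ↔' ψ = (φ →' ψ) ∧' (ψ →' φ)

_≡'_ : ∀ {v} {V : Set v} → Formula V → Formula V → Formula V
φ ≡' ψ = □ (φ ↔' ψ)

module _ {c ℓ₁ ℓ₂ : Level} (H : HeytingAlgebra c ℓ₁ ℓ₂) where
  open HeytingAlgebra H

  record IsFilter {ℓ : Level} (F : Pred Carrier ℓ) : Set (c ⊔ ℓ₁ ⊔ ℓ₂ ⊔ ℓ) where
    field
      resp-≈   : ∀ {x y} → x ≈ y → x ∈ F → y ∈ F
      has-⊤    : ⊤ ∈ F
      up-closed : ∀ {x y} → x ≤ y → x ∈ F → y ∈ F
      ∧-closed : ∀ {x y} → x ∈ F → y ∈ F → (x ∧ y) ∈ F

  record IsProperFilter {ℓ : Level} (F : Pred Carrier ℓ) : Set (c ⊔ ℓ₁ ⊔ ℓ₂ ⊔ ℓ) where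
    field
      isFilter : IsFilter F
      no-⊥     : ⊥ ∉ F

  record IsUltrafilter {ℓ : Level} (F : Pred Carrier ℓ) : Set (c ⊔ ℓ₁ ⊔ ℓ₂ ⊔ suc ℓ) where
    field
      isProperFilter : IsProperFilter F
      maximal        : ∀ (G : Pred Carrier ℓ) → IsProperFilter G → F ⊆ G → G ⊆ F

record EL3⁻Model (c ℓ₁ ℓ₂ ℓ : Level) : Set (suc (c ⊔ ℓ₁ ⊔ ℓ₂ ⊔ ℓ)) where
  field
    heyting : HeytingAlgebra c ℓ₁ ℓ₂
  open HeytingAlgebra heyting public
  field
    TRUE : Pred Carrier ℓ
    BEL  : Pred Carrier ℓ
    f□   : Carrier → Carrier
    fK   : Carrier → Carrier
    -- operations are functions on the carrier: they respect its equality
    f□-cong  : ∀ {m m'} → m ≈ m' → f□ m ≈ f□ m'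
    fK-cong  : ∀ {m m'} → m ≈ m' → fK m ≈ fK m'
    BEL-resp : ∀ {m m'} → m ≈ m' → m ∈ BEL → m' ∈ BEL
    TRUE-ultra : IsUltrafilter heyting TRUE
    ax-i   : ∀ m m' → f□ (m ∨ m') ≤ (f□ m ∨ f□ m')
    ax-ii  : ∀ m → f□ m ≤ m
    ax-iii : ∀ m m' → f□ (m ⇨ m') ≤ f□ (f□ m ⇨ f□ m')
    ax-iv  : ∀ m → (f□ m ∈ TRUE → m ≈ ⊤) × (m ≈ ⊤ → f□ m ∈ TRUE)
    ax-v   : ∀ m → (fK m ∈ TRUE → m ∈ BEL) × (m ∈ BEL → fK m ∈ TRUE)
    ax-vi  : ∀ m m' → fK (m ⇨ m') ≤ (fK m ⇨ fK m')
    ax-vii : ∀ m → f□ m ≤ f□ (fK m)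

module _ {c ℓ₁ ℓ₂ ℓ : Level} (𝓜 : EL3⁻Model c ℓ₁ ℓ₂ ℓ) where
  open EL3⁻Model 𝓜

  ⟦_⟧ : ∀ {v} {V : Set v} → Formula V → (V → Carrier) → Carrier
  ⟦ var x ⟧ γ = γ x
  ⟦ ⊥' ⟧ γ = ⊥
  ⟦ φ ∧' ψ ⟧ γ = ⟦ φ ⟧ γ ∧ ⟦ ψ ⟧ γ
  ⟦ φ ∨' ψ ⟧ γ = ⟦ φ ⟧ γ ∨ ⟦ ψ ⟧ γ
  ⟦ φ →' ψ ⟧ γ = ⟦ φ ⟧ γ ⇨ ⟦ ψ ⟧ γ
  ⟦ □ φ ⟧ γ = f□ (⟦ φ ⟧ γ)
  ⟦ K φ ⟧ γ = fK (⟦ φ ⟧ γ)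

  _,_⊨_ : ∀ {v} {V : Set v} → (V → Carrier) → Formula V → Set ℓ
  _,_⊨_ γ φ = ⟦ φ ⟧ γ ∈ TRUE

module Submission where

open import Defs
open import Level using (Level)
open import Function.Bundles using (_⇔_; mk⇔)
open import Data.Product using (proj₁; proj₂)
open import Relation.Binary.Lattice.Bundles using (HeytingAlgebra)
import Relation.Binary.Lattice.Properties.HeytingAlgebra as HeytingAlgebraProperties

-- By (iv), □(φ ↔ ψ) is true exactly when γ(φ ↔ ψ) = ⊤, and in a Heyting
-- algebra (a ⇨ b) ∧ (b ⇨ a) = ⊤ holds exactly when a = b.

module _ {c ℓ₁ ℓ₂ : Level} (H : HeytingAlgebra c ℓ₁ ℓ₂) where
  open HeytingAlgebra H
  open HeytingAlgebraProperties H using (⇨-applyʳ; ⇨-unit; ⇨-cong)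

  ⊤≤⇨⇒≤ : ∀ {a b} → ⊤ ≤ (a ⇨ b) → a ≤ b
  ⊤≤⇨⇒≤ {a} ⊤≤a⇨b = trans (∧-greatest refl (trans (maximum a) ⊤≤a⇨b)) (⇨-applyʳ refl)

  ≈⇒⇨≈⊤ : ∀ {a b} → a ≈ b → (a ⇨ b) ≈ ⊤
  ≈⇒⇨≈⊤ a≈b = Eq.trans (⇨-cong Eq.refl (Eq.sym a≈b)) ⇨-unit

  ⇨∧⇨≈⊤⇒≈ : ∀ {a b} → ((a ⇨ b) ∧ (b ⇨ a)) ≈ ⊤ → a ≈ b
  ⇨∧⇨≈⊤⇒≈ eq = antisym (⊤≤⇨⇒≤ (trans ⊤≤⇨∧⇨ (x∧y≤x _ _))) (⊤≤⇨⇒≤ (trans ⊤≤⇨∧⇨ (x∧y≤y _ _)))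
    where ⊤≤⇨∧⇨ = reflexive (Eq.sym eq)

  ≈⇒⇨∧⇨≈⊤ : ∀ {a b} → a ≈ b → ((a ⇨ b) ∧ (b ⇨ a)) ≈ ⊤
  ≈⇒⇨∧⇨≈⊤ a≈b = antisym (maximum _)
    (∧-greatest (reflexive (Eq.sym (≈⇒⇨≈⊤ a≈b))) (reflexive (Eq.sym (≈⇒⇨≈⊤ (Eq.sym a≈b)))))

lemma3p15 : ∀ {c ℓ₁ ℓ₂ ℓ v : Level} (𝓜 : EL3⁻Model c ℓ₁ ℓ₂ ℓ) {V : Set v}
            (γ : V → EL3⁻Model.Carrier 𝓜) (φ ψ : Formula V) →
            (_,_⊨_ 𝓜 γ (φ ≡' ψ)) ⇔ EL3⁻Model._≈_ 𝓜 (⟦_⟧ 𝓜 φ γ) (⟦_⟧ 𝓜 ψ γ)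
lemma3p15 𝓜 γ φ ψ = mk⇔
  (λ □↔-true → ⇨∧⇨≈⊤⇒≈ heyting (proj₁ (ax-iv _) □↔-true))
  (λ φ≈ψ → proj₂ (ax-iv _) (≈⇒⇨∧⇨≈⊤ heyting φ≈ψ))
  where open EL3⁻Model 𝓜
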